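{- Let $G$ be any graph. Then $\mathbf{vsrc}(G)\le \min\{\lfloor |V(G)|^2/4\rfloor, |E(G)|\}$.
   Context: All graphs are finite, simple and undirected. A very strong rainbow coloring of $G$ is a coloring of $E(G)$ such that for every pair of vertices and every shortest path between them, all edges of that path receive pairwise different colors; $\mathbf{vsrc}(G)$ is the minimum number of colors in such a coloring. -}

module Defs where

open import Data.Nat using (ℕ; zero; suc; _<_; _≤_; _⊓_; _*_; _/_)
open import Data.Nat.Properties using (_<?_)
open import Data.Bool using (Bool; true; false; T; _∧_)
open import Data.Fin using (Fin; toℕ; inject₁) renaming (suc to fsuc)
open import Data.List using (List; map; allFin; filter)
open import Data.Nat.ListAction using (sum)
import Data.Bool
open import Data.List using (length)
open import Data.Product using (Σ; _×_; ∃-syntax)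
open import Relation.Binary.PropositionalEquality using (_≡_)
open import Relation.Nullary using (¬_)
open import Relation.Nullary.Decidable using (⌊_⌋)
open import Function.Definitions using (Injective)

record Graph : Set where
  field
    n      : ℕ
    adj    : Fin n → Fin n → Bool
    symm   : ∀ i j → adj i j ≡ adj j i
    irrefl : ∀ i → adj i i ≡ false

open Graph public

Adj : (G : Graph) → Fin (n G) → Fin (n G) → Set
Adj G i j = T (adj G i j)

adj-sym : (G : Graph) {i j : Fin (n G)} → Adj G i j → Adj G j i
adj-sym G {i} {j} a with adj G i j | adj G j i | symm G i j
... | true | true | _ = a

order : Graph → ℕ
order G = n G

size : Graph → ℕ
size G = sum (map (λ i → length (filter (λ j → Data.Bool._≟_ (adj G i j ∧ ⌊ toℕ i <? toℕ j ⌋) true) (allFin (n G)))) (allFin (n G)))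

record EdgeColouring (G : Graph) (k : ℕ) : Set where
  field
    col     : (i j : Fin (n G)) → Adj G i j → Fin k
    col-sym : ∀ i j (a : Adj G i j) → col i j a ≡ col j i (adj-sym G a)

open EdgeColouring public

record Walk (G : Graph) (u v : Fin (n G)) (ℓ : ℕ) : Set where
  field
    vert  : Fin (suc ℓ) → Fin (n G)
    start : vert Data.Fin.zero ≡ u
    end   : vert (Data.Fin.fromℕ ℓ) ≡ v
    step  : (i : Fin ℓ) → Adj G (vert (inject₁ i)) (vert (fsuc i))

open Walk public

IsShortest : (G : Graph) {u v : Fin (n G)} {ℓ : ℕ} → Walk G u v ℓ → Set
IsShortest G {u} {v} {ℓ} _ = ∀ m → m < ℓ → ¬ Walk G u v m

edgeCol : {G : Graph} {k : ℕ} → EdgeColouring G k →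
          {u v : Fin (n G)} {ℓ : ℕ} → (w : Walk G u v ℓ) → Fin ℓ → Fin k
edgeCol c w i = col c _ _ (step w i)

IsVSRC : (G : Graph) {k : ℕ} → EdgeColouring G k → Set
IsVSRC G c = ∀ (u v : Fin (n G)) (ℓ : ℕ) (w : Walk G u v ℓ) →
             IsShortest G w → Injective _≡_ _≡_ (edgeCol c w)

-- vsrc(G) ≤ m  iff  there is a very strong rainbow colouring using (at most) m colours
vsrc≤ : Graph → ℕ → Set
vsrc≤ G m = Σ (EdgeColouring G m) (IsVSRC G)

module Submission where

-- Colour every edge by a clique containing it, taken from a family of cliques covering all
-- edges. On a shortest path two distinct edges never share a colour: the outer endpoints of
-- the two edges would lie in one clique, hence be equal or adjacent, and the path could be
-- shortened. So vsrc(G) is at most the edge clique cover number, which is at most |E(G)|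
-- (one clique per edge) and at most ⌊n²/4⌋ (Erdős–Goodman–Pósa): remove an edge xy, cover
-- the rest inductively and add the clique {x, y} together with, for each of the n − 2 other
-- vertices z, the clique of z and its neighbours among x, y; ⌊(n−2)²/4⌋ + n − 1 = ⌊n²/4⌋.

open import Defs
open import Data.Nat using (ℕ; zero; suc; _+_; _∸_; _≤_; _<_; z≤n; s≤s; s≤s⁻¹; _⊓_; _*_; _/_)
open import Data.Nat.Properties hiding (_≟_)
open import Data.Nat.DivMod using (+-distrib-/-∣ʳ; m*n/n≡m; /-monoˡ-≤)
open import Data.Nat.Divisibility using (n∣m*n)
open import Data.Nat.ListAction using (sum)
open import Data.Nat.Tactic.RingSolver using (solve-∀)
open import Data.Fin using (Fin; toℕ; fromℕ; _≟_; inject₁; inject≤; join; splitAt) renaming (zero to fzero; suc to fsuc)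
open import Data.Fin.Properties using (toℕ-injective; toℕ-inject₁; toℕ<n; inject≤-injective; splitAt-join)
open import Data.Bool using (T; true; _∧_)
import Data.Bool
open import Data.Bool.Properties using (T-irrelevant; T-≡; T-∧)
open import Data.List using (List; []; _∷_; map; concatMap; allFin; filter; length; lookup)
open import Data.List.Properties using (length-++; length-map; map-cong; length-tabulate; filter-notAll)
open import Data.List.Relation.Unary.Any as Any using (index; any?)
open import Data.List.Relation.Unary.Any.Properties using (lookup-index)
open import Data.List.Membership.Propositional using (_∈_; find; lose)
open import Data.List.Membership.Propositional.Properties using (∈-filter⁺; ∈-allFin; ∈-map⁺; ∈-concatMap⁺)
open import Data.Product using (Σ-syntax; ∃-syntax; _×_; _,_; proj₁; proj₂; map₂; swap)
open import Data.Sum using (_⊎_; inj₁; inj₂)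
open import Data.Empty using (⊥; ⊥-elim)
open import Function using (_∘_; Equivalence)
open import Function.Definitions using (Injective)
open import Relation.Binary using (tri<; tri≈; tri>)
open import Relation.Binary.PropositionalEquality using (_≡_; _≢_; refl; sym; trans; cong; subst; module ≡-Reasoning)
open import Relation.Nullary using (¬_; yes; no; ¬?)
open import Relation.Nullary.Decidable using (⌊_⌋; fromWitness; T?)

length-concatMap : {A B : Set} (f : A → List B) (xs : List A) →
                   length (concatMap f xs) ≡ sum (map (length ∘ f) xs)
length-concatMap f []       = refl
length-concatMap f (x ∷ xs) = trans (length-++ (f x)) (cong (length (f x) +_) (length-concatMap f xs))

shortcut-length : ∀ {a b ℓ m} → suc a < b → b ≤ ℓ → m ≤ 1 → a + (m + (ℓ ∸ b)) < ℓ
shortcut-length {a} {b} {ℓ} {m} a+1<b b≤ℓ m≤1 = begin-strict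
  a + (m + (ℓ ∸ b))  ≤⟨ +-monoʳ-≤ a (+-monoˡ-≤ (ℓ ∸ b) m≤1) ⟩
  a + suc (ℓ ∸ b)    ≡⟨ +-suc a (ℓ ∸ b) ⟩
  suc a + (ℓ ∸ b)    <⟨ +-monoˡ-< (ℓ ∸ b) a+1<b ⟩
  b + (ℓ ∸ b)        ≡⟨ m+[n∸m]≡n b≤ℓ ⟩
  ℓ                  ∎
  where open ≤-Reasoning

quarterSquare : ℕ → ℕ
quarterSquare m = m * m / 4

quarterSquare-mono : ∀ {m m′} → m ≤ m′ → quarterSquare m ≤ quarterSquare m′
quarterSquare-mono m≤m′ = /-monoˡ-≤ 4 (*-mono-≤ m≤m′ m≤m′)

quarterSquare-+2 : ∀ m → quarterSquare m + suc m ≡ quarterSquare (2 + m)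
quarterSquare-+2 m = begin
  m * m / 4 + suc m            ≡⟨ cong (m * m / 4 +_) (sym (m*n/n≡m (suc m) 4)) ⟩
  m * m / 4 + suc m * 4 / 4    ≡⟨ sym (+-distrib-/-∣ʳ (m * m) (n∣m*n (suc m))) ⟩
  (m * m + suc m * 4) / 4      ≡⟨ cong (_/ 4) (square-+2 m) ⟩
  (2 + m) * (2 + m) / 4        ∎
  where
  open ≡-Reasoning
  square-+2 : ∀ m → m * m + suc m * 4 ≡ (2 + m) * (2 + m)
  square-+2 = solve-∀

Vertex : Graph → Set
Vertex G = Fin (n G)

Close : (G : Graph) → Vertex G → Vertex G → Set
Close G u v = u ≡ v ⊎ Adj G u v

adj⇒≢ : (G : Graph) {a b : Vertex G} → Adj G a b → a ≢ b
adj⇒≢ G {a} e refl = subst T (irrefl G a) e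

module _ (G : Graph) where

  data Path : Vertex G → Vertex G → ℕ → Set where
    []  : ∀ {u} → Path u u 0
    _∷_ : ∀ {u x v ℓ} → Adj G u x → Path x v ℓ → Path u v (suc ℓ)

  _++_ : ∀ {u x v ℓ ℓ′} → Path u x ℓ → Path x v ℓ′ → Path u v (ℓ + ℓ′)
  []      ++ q = q
  (e ∷ p) ++ q = e ∷ (p ++ q)

  close⇒path : ∀ {u v} → Close G u v → ∃[ m ] m ≤ 1 × Path u v m
  close⇒path (inj₁ refl) = 0 , z≤n , []
  close⇒path (inj₂ e)    = 1 , ≤-refl , e ∷ []

  pathVert : ∀ {u v ℓ} → Path u v ℓ → Fin (suc ℓ) → Vertex G
  pathVert {u} p       fzero    = u
  pathVert     (e ∷ p) (fsuc i) = pathVert p i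

  pathVert-end : ∀ {u v ℓ} (p : Path u v ℓ) → pathVert p (fromℕ ℓ) ≡ v
  pathVert-end []      = refl
  pathVert-end (e ∷ p) = pathVert-end p

  pathVert-step : ∀ {u v ℓ} (p : Path u v ℓ) (i : Fin ℓ) →
                  Adj G (pathVert p (inject₁ i)) (pathVert p (fsuc i))
  pathVert-step (e ∷ p) fzero    = e
  pathVert-step (e ∷ p) (fsuc i) = pathVert-step p i

  path⇒walk : ∀ {u v ℓ} → Path u v ℓ → Walk G u v ℓ
  path⇒walk p = record { vert = pathVert p ; start = refl ; end = pathVert-end p ; step = pathVert-step p }

  walk-tail : ∀ {u v ℓ} (w : Walk G u v (suc ℓ)) → Walk G (vert w (fsuc fzero)) v ℓ
  walk-tail w = record { vert = vert w ∘ fsuc ; start = refl ; end = end w ; step = step w ∘ fsuc }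

  walk-prefix : ∀ {u v ℓ} (w : Walk G u v ℓ) (i : Fin (suc ℓ)) →
                Path (vert w fzero) (vert w i) (toℕ i)
  walk-prefix                w fzero    = []
  walk-prefix {ℓ = suc ℓ}    w (fsuc i) = step w fzero ∷ walk-prefix (walk-tail w) i

  walk-suffix : ∀ {u v ℓ} (w : Walk G u v ℓ) (i : Fin (suc ℓ)) → Path (vert w i) v (ℓ ∸ toℕ i)
  walk-suffix {ℓ = zero}  w fzero    = subst (λ z → Path (vert w fzero) z 0) (end w) []
  walk-suffix {ℓ = suc ℓ} w fzero    = step w fzero ∷ walk-suffix (walk-tail w) fzero
  walk-suffix {ℓ = suc ℓ} w (fsuc i) = walk-suffix (walk-tail w) i

  shortcut : ∀ {u v ℓ} (w : Walk G u v ℓ) (i j : Fin (suc ℓ)) → suc (toℕ i) < toℕ j →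
             Close G (vert w i) (vert w j) → ∃[ m ] m < ℓ × Walk G u v m
  shortcut w i j i+1<j c with close⇒path c
  ... | m , m≤1 , bridge =
    _ , shortcut-length i+1<j (s≤s⁻¹ (toℕ<n j)) m≤1 ,
    path⇒walk (subst (λ z → Path z _ _) (start w) (walk-prefix w i ++ (bridge ++ walk-suffix w j)))

record CliqueCover (G : Graph) (S : Vertex G → Set) (I : Set) : Set₁ where
  field
    clique   : I → Vertex G → Set
    isClique : ∀ i {u v} → clique i u → clique i v → Close G u v
    cover    : ∀ {a b} → S a → S b → Adj G a b → Σ[ i ∈ I ] clique i a × clique i b

open CliqueCover

module _ (G : Graph) {S : Vertex G → Set} {k : ℕ} (everywhere : ∀ v → S v)
         (C : CliqueCover G S (Fin k)) where

  -- Covering an edge from its smaller endpoint makes the colour independent of orientation.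
  orientedCover : (a b : Vertex G) (e : Adj G a b) → Σ[ κ ∈ Fin k ] clique C κ a × clique C κ b
  orientedCover a b e with toℕ a <? toℕ b
  ... | yes _ = cover C (everywhere a) (everywhere b) e
  ... | no _  = map₂ swap (cover C (everywhere b) (everywhere a) (adj-sym G e))

  orientedCover-sym : ∀ a b (e : Adj G a b) →
                      proj₁ (orientedCover a b e) ≡ proj₁ (orientedCover b a (adj-sym G e))
  orientedCover-sym a b e with toℕ a <? toℕ b | toℕ b <? toℕ a
  ... | yes a<b | yes b<a = ⊥-elim (<-asym a<b b<a)
  ... | yes _   | no _    = cong (λ e′ → proj₁ (cover C (everywhere a) (everywhere b) e′)) (T-irrelevant _ _)
  ... | no _    | yes _   = refl
  ... | no a≮b  | no b≮a  = ⊥-elim (adj⇒≢ G e a≡b)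
    where a≡b = toℕ-injective (≤-antisym (≮⇒≥ b≮a) (≮⇒≥ a≮b))

  cliqueColouring : EdgeColouring G k
  cliqueColouring = record { col = λ a b e → proj₁ (orientedCover a b e) ; col-sym = orientedCover-sym }

  shortest-no-repeat : ∀ {u v ℓ} (w : Walk G u v ℓ) → IsShortest G w → (x y : Fin ℓ) → toℕ x < toℕ y →
                       edgeCol cliqueColouring w x ≢ edgeCol cliqueColouring w y
  shortest-no-repeat w shortest x y x<y same =
    let m , m<ℓ , w′ = shortcut G w (inject₁ x) (fsuc y) x+1<y+1 close in shortest m m<ℓ w′
    where
    x+1<y+1 : suc (toℕ (inject₁ x)) < toℕ (fsuc y)
    x+1<y+1 = subst (λ t → suc t < suc (toℕ y)) (sym (toℕ-inject₁ x)) (s≤s x<y)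
    close : Close G (vert w (inject₁ x)) (vert w (fsuc y))
    close = isClique C _ (proj₁ (proj₂ (orientedCover _ _ (step w x))))
                         (subst (λ κ → clique C κ (vert w (fsuc y))) (sym same)
                                (proj₂ (proj₂ (orientedCover _ _ (step w y)))))

  cliqueColouring-rainbow : IsVSRC G cliqueColouring
  cliqueColouring-rainbow u v ℓ w shortest {x} {y} same with <-cmp (toℕ x) (toℕ y)
  ... | tri< x<y _ _ = ⊥-elim (shortest-no-repeat w shortest x y x<y same)
  ... | tri≈ _ x≡y _ = toℕ-injective x≡y
  ... | tri> _ _ y<x = ⊥-elim (shortest-no-repeat w shortest y x y<x (sym same))

cliqueCover⇒vsrc≤ : (G : Graph) {S : Vertex G → Set} {k : ℕ} → (∀ v → S v) →
                    CliqueCover G S (Fin k) → vsrc≤ G k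
cliqueCover⇒vsrc≤ G everywhere C = cliqueColouring G everywhere C , cliqueColouring-rainbow G everywhere C

module _ {G : Graph} {S : Vertex G → Set} where

  reindex : ∀ {I J} (f : I → J) → Injective _≡_ _≡_ f → CliqueCover G S I → CliqueCover G S J
  reindex {I} f f-inj C = record
    { clique   = λ j v → Σ[ i ∈ I ] f i ≡ j × clique C i v
    ; isClique = λ { j (i , fi≡j , u∈i) (i′ , fi′≡j , v∈i′) →
                     isClique C i u∈i (subst (λ i″ → clique C i″ _) (f-inj (trans fi′≡j (sym fi≡j))) v∈i′) }
    ; cover    = λ Sa Sb e → let i , a∈i , b∈i = cover C Sa Sb e in f i , (i , refl , a∈i) , (i , refl , b∈i)
    }

  edgeless : ∀ {I} → (∀ {a b} → S a → S b → ¬ Adj G a b) → CliqueCover G S I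
  edgeless no-edge = record
    { clique   = λ _ _ → ⊥
    ; isClique = λ _ ()
    ; cover    = λ Sa Sb e → ⊥-elim (no-edge Sa Sb e)
    }

  -- The adjacency component makes this a clique whether or not e is an edge.
  EdgeEnd : Vertex G × Vertex G → Vertex G → Set
  EdgeEnd e v = (v ≡ proj₁ e ⊎ v ≡ proj₂ e) × Adj G (proj₁ e) (proj₂ e)

  edgeEnd-close : ∀ e {u v} → EdgeEnd e u → EdgeEnd e v → Close G u v
  edgeEnd-close e (inj₁ refl , h) (inj₁ refl , _) = inj₁ refl
  edgeEnd-close e (inj₁ refl , h) (inj₂ refl , _) = inj₂ h
  edgeEnd-close e (inj₂ refl , h) (inj₁ refl , _) = inj₂ (adj-sym G h)
  edgeEnd-close e (inj₂ refl , h) (inj₂ refl , _) = inj₁ refl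

  edgeListCover : (E : List (Vertex G × Vertex G)) → (∀ {a b} → Adj G a b → (a , b) ∈ E ⊎ (b , a) ∈ E) →
                  CliqueCover G S (Fin (length E))
  edgeListCover E listed = record
    { clique   = λ i → EdgeEnd (lookup E i)
    ; isClique = λ i → edgeEnd-close (lookup E i)
    ; cover    = λ {a} {b} _ _ e → cover-edge a b e (listed e)
    }
    where
    cover-edge : ∀ a b → Adj G a b → (a , b) ∈ E ⊎ (b , a) ∈ E →
                 Σ[ i ∈ Fin (length E) ] EdgeEnd (lookup E i) a × EdgeEnd (lookup E i) b
    cover-edge a b e (inj₁ ab∈E) = index ab∈E ,
      subst (λ p → EdgeEnd p a) (lookup-index ab∈E) (inj₁ refl , e) ,
      subst (λ p → EdgeEnd p b) (lookup-index ab∈E) (inj₂ refl , e)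
    cover-edge a b e (inj₂ ba∈E) = index ba∈E ,
      subst (λ p → EdgeEnd p a) (lookup-index ba∈E) (inj₂ refl , adj-sym G e) ,
      subst (λ p → EdgeEnd p b) (lookup-index ba∈E) (inj₁ refl , adj-sym G e)

module _ {G : Graph} {x y : Vertex G} (xy : Adj G x y) where

  EndOfXY : Vertex G → Set
  EndOfXY v = v ≡ x ⊎ v ≡ y

  endOfXY-close : ∀ {u v} → EndOfXY u → EndOfXY v → Close G u v
  endOfXY-close (inj₁ refl) (inj₁ refl) = inj₁ refl
  endOfXY-close (inj₁ refl) (inj₂ refl) = inj₂ xy
  endOfXY-close (inj₂ refl) (inj₁ refl) = inj₂ (adj-sym G xy)
  endOfXY-close (inj₂ refl) (inj₂ refl) = inj₁ refl

  Star : Vertex G → Vertex G → Set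
  Star z v = v ≡ z ⊎ (EndOfXY v × Adj G v z)

  star-close : ∀ z {u v} → Star z u → Star z v → Close G u v
  star-close z (inj₁ refl)      (inj₁ refl)      = inj₁ refl
  star-close z (inj₁ refl)      (inj₂ (_ , vz))  = inj₂ (adj-sym G vz)
  star-close z (inj₂ (_ , uz))  (inj₁ refl)      = inj₂ uz
  star-close z (inj₂ (xyu , _)) (inj₂ (xyv , _)) = endOfXY-close xyu xyv

  module _ (L : List (Vertex G)) where

    newClique : Fin (suc (length L)) → Vertex G → Set
    newClique fzero    = EndOfXY
    newClique (fsuc j) = Star (lookup L j)

    newClique-close : ∀ j {u v} → newClique j u → newClique j v → Close G u v
    newClique-close fzero    = endOfXY-close
    newClique-close (fsuc j) = star-close (lookup L j)

    star-cover : ∀ {a b} → EndOfXY a → b ∈ L → Adj G a b →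
                 Σ[ j ∈ Fin (suc (length L)) ] newClique j a × newClique j b
    star-cover xya b∈L ab = fsuc (index b∈L) ,
      inj₂ (xya , subst (Adj G _) (lookup-index b∈L) ab) , inj₁ (lookup-index b∈L)

    extendCover : ∀ {S I} → (∀ {a} → S a → EndOfXY a ⊎ a ∈ L) →
                  CliqueCover G (_∈ L) I → CliqueCover G S (I ⊎ Fin (suc (length L)))
    extendCover {S} {I} split C = record
      { clique   = clique′
      ; isClique = λ { (inj₁ i) → isClique C i ; (inj₂ j) → newClique-close j }
      ; cover    = λ {a} {b} Sa Sb e → cover′ (split Sa) (split Sb) e
      }
      where
      clique′ : I ⊎ Fin (suc (length L)) → Vertex G → Set
      clique′ (inj₁ i) = clique C i
      clique′ (inj₂ j) = newClique j
      cover′ : ∀ {a b} → EndOfXY a ⊎ a ∈ L → EndOfXY b ⊎ b ∈ L → Adj G a b →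
               Σ[ i ∈ I ⊎ Fin (suc (length L)) ] clique′ i a × clique′ i b
      cover′ (inj₁ xya) (inj₁ xyb) e = inj₂ fzero , xya , xyb
      cover′ (inj₁ xya) (inj₂ b∈L) e = let j , a∈j , b∈j = star-cover xya b∈L e in inj₂ j , a∈j , b∈j
      cover′ (inj₂ a∈L) (inj₁ xyb) e = let j , b∈j , a∈j = star-cover xyb a∈L (adj-sym G e) in inj₂ j , a∈j , b∈j
      cover′ (inj₂ a∈L) (inj₂ b∈L) e = let i , a∈i , b∈i = cover C a∈L b∈L e in inj₁ i , a∈i , b∈i

module _ (G : Graph) where

  -- The filter of the definition of size, so that length-orderedEdges needs no counting argument.
  laterNeighbours : Vertex G → List (Vertex G)
  laterNeighbours i = filter (λ j → Data.Bool._≟_ (adj G i j ∧ ⌊ toℕ i <? toℕ j ⌋) true) (allFin (n G))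

  orderedEdges : List (Vertex G × Vertex G)
  orderedEdges = concatMap (λ i → map (i ,_) (laterNeighbours i)) (allFin (n G))

  length-orderedEdges : length orderedEdges ≡ size G
  length-orderedEdges = trans (length-concatMap (λ i → map (i ,_) (laterNeighbours i)) (allFin (n G)))
                              (cong sum (map-cong (λ i → length-map (i ,_) (laterNeighbours i)) (allFin (n G))))

  ∈-orderedEdges : ∀ {a b} → Adj G a b → toℕ a < toℕ b → (a , b) ∈ orderedEdges
  ∈-orderedEdges {a} {b} e a<b = ∈-concatMap⁺ _ (lose (∈-allFin a) (∈-map⁺ (a ,_) b∈later))
    where
    b∈later : b ∈ laterNeighbours a
    b∈later = ∈-filter⁺ _ (∈-allFin b) (Equivalence.to T-≡ (Equivalence.from T-∧ (e , fromWitness a<b)))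

  orderedEdges-complete : ∀ {a b} → Adj G a b → (a , b) ∈ orderedEdges ⊎ (b , a) ∈ orderedEdges
  orderedEdges-complete {a} {b} e with <-cmp (toℕ a) (toℕ b)
  ... | tri< a<b _ _ = inj₁ (∈-orderedEdges e a<b)
  ... | tri≈ _ a≡b _ = ⊥-elim (adj⇒≢ G e (toℕ-injective a≡b))
  ... | tri> _ _ b<a = inj₂ (∈-orderedEdges (adj-sym G e) b<a)

  sizeCliqueCover : ∀ {S} → CliqueCover G S (Fin (size G))
  sizeCliqueCover = subst (CliqueCover G _ ∘ Fin) length-orderedEdges
                          (edgeListCover orderedEdges orderedEdges-complete)

  removePair : Vertex G → Vertex G → List (Vertex G) → List (Vertex G)
  removePair x y = filter (λ a → ¬? (a ≟ y)) ∘ filter (λ a → ¬? (a ≟ x))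

  ∈-removePair : ∀ {x y a L} → a ∈ L → (a ≡ x ⊎ a ≡ y) ⊎ a ∈ removePair x y L
  ∈-removePair {x} {y} {a} a∈L with a ≟ x | a ≟ y
  ... | yes a≡x | _       = inj₁ (inj₁ a≡x)
  ... | no _    | yes a≡y = inj₁ (inj₂ a≡y)
  ... | no a≢x  | no a≢y  = inj₂ (∈-filter⁺ _ (∈-filter⁺ _ a∈L a≢x) a≢y)

  length-removePair : ∀ {x y L} → x ∈ L → y ∈ L → x ≢ y → 2 + length (removePair x y L) ≤ length L
  length-removePair {x} {y} x∈L y∈L x≢y =
    ≤-trans (s≤s (filter-notAll _ _ (Any.map (λ { refl y≢y → y≢y refl }) y∈L′)))
            (filter-notAll _ _ (Any.map (λ { refl x≢x → x≢x refl }) x∈L))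
    where
    y∈L′ = ∈-filter⁺ (λ a → ¬? (a ≟ x)) y∈L (x≢y ∘ sym)

  quarterSquareCover-step : ∀ {x y L} → Adj G x y → x ∈ L → y ∈ L →
    CliqueCover G (_∈ removePair x y L) (Fin (quarterSquare (length (removePair x y L)))) →
    CliqueCover G (_∈ L) (Fin (quarterSquare (length L)))
  quarterSquareCover-step {x} {y} {L} xy x∈L y∈L C =
    reindex embed embed-injective (extendCover xy (removePair x y L) ∈-removePair C)
    where
    s = length (removePair x y L)
    k = quarterSquare s
    k+s+1≤ : k + suc s ≤ quarterSquare (length L)
    k+s+1≤ = subst (_≤ quarterSquare (length L)) (sym (quarterSquare-+2 s))
                   (quarterSquare-mono (length-removePair x∈L y∈L (adj⇒≢ G xy)))
    embed : Fin k ⊎ Fin (suc s) → Fin (quarterSquare (length L))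
    embed i = inject≤ (join k (suc s) i) k+s+1≤
    embed-injective : Injective _≡_ _≡_ embed
    embed-injective {i} {j} eq = begin
      i                              ≡⟨ splitAt-join k (suc s) i ⟨
      splitAt k (join k (suc s) i)   ≡⟨ cong (splitAt k) (inject≤-injective k+s+1≤ k+s+1≤ _ _ eq) ⟩
      splitAt k (join k (suc s) j)   ≡⟨ splitAt-join k (suc s) j ⟩
      j                              ∎
      where open ≡-Reasoning

  quarterSquareCover : ∀ s (L : List (Vertex G)) → length L ≤ s →
                       CliqueCover G (_∈ L) (Fin (quarterSquare (length L)))
  quarterSquareCover zero    []  _ = edgeless (λ ())
  quarterSquareCover (suc s) L |L|≤1+s with any? (λ a → any? (λ b → T? (adj G a b)) L) L
  ... | no no-edge = edgeless (λ a∈L b∈L ab → no-edge (lose a∈L (lose b∈L ab)))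
  ... | yes has-edge =
    let x , x∈L , has-neighbour = find has-edge
        y , y∈L , xy            = find has-neighbour
        |L′|+2≤|L|              = length-removePair x∈L y∈L (adj⇒≢ G xy)
    in quarterSquareCover-step xy x∈L y∈L
         (quarterSquareCover s _ (≤-trans (n≤1+n _) (s≤s⁻¹ (≤-trans |L′|+2≤|L| |L|≤1+s))))

  allVerticesCover : CliqueCover G (_∈ allFin (n G)) (Fin (order G * order G / 4))
  allVerticesCover = subst (CliqueCover G (_∈ allFin (n G)) ∘ Fin ∘ quarterSquare)
                           (length-tabulate {n = n G} (λ i → i))
                           (quarterSquareCover _ (allFin (n G)) ≤-refl)

corollary1 : (G : Graph) → vsrc≤ G (((order G * order G) / 4) ⊓ size G)
corollary1 G with ⊓-sel (order G * order G / 4) (size G)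
... | inj₁ min≡quarter = subst (vsrc≤ G) (sym min≡quarter) (cliqueCover⇒vsrc≤ G ∈-allFin (allVerticesCover G))
... | inj₂ min≡size    = subst (vsrc≤ G) (sym min≡size) (cliqueCover⇒vsrc≤ G ∈-allFin (sizeCliqueCover G))
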